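{- Let $b$ be a rational number and let $p=(p_0,p_1)$, $q=(q_0,q_1)$, $r=(r_0,r_1)$ be pairs of rational numbers, none equal to $(0,0)$. Put $p^L=(p_1,-p_0)$, $q^L=(q_1,-q_0)$, $r^L=(r_1,-r_0)$, and for $i,j,k\in\{0,1\}$ define $$a_{ijk}=b\,p^L_iq^L_jr^L_k+\frac{p_iq^L_jr^L_k}{p_0^2+p_1^2}+\frac{p^L_iq_jr^L_k}{q_0^2+q_1^2}+\frac{p^L_iq^L_jr_k}{r_0^2+r_1^2}.$$ Then for each $k\in\{0,1\}$, $$a_{k01}a_{k10}-a_{k00}a_{k11}=(p^L_k)^2,\quad a_{0k1}a_{1k0}-a_{0k0}a_{1k1}=(q^L_k)^2,\quad a_{01k}a_{10k}-a_{00k}a_{11k}=(r^L_k)^2,$$ so all six of these face quantities are squares of rationals, and the Cayley hyperdeterminant of $A=(a_{ijk})$ vanishes, where $$\operatorname{Det}(A)=a_{000}^2a_{111}^2+a_{001}^2a_{110}^2+a_{010}^2a_{101}^2+a_{100}^2a_{011}^2-2\big(a_{000}a_{111}a_{001}a_{110}+a_{000}a_{111}a_{010}a_{101}+a_{000}a_{111}a_{011}a_{100}+a_{001}a_{110}a_{010}a_{101}+a_{001}a_{110}a_{011}a_{100}+a_{010}a_{101}a_{011}a_{100}\big)+4\big(a_{000}a_{011}a_{101}a_{110}+a_{001}a_{010}a_{100}a_{111}\big).$$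
   Context: This is a symmetric parameterisation of regular solutions of the problem of finding a rational $2\times2\times2$ hypermatrix with vanishing hyperdeterminant whose six (signed) face determinants are rational squares. -}

module Defs where

open import Data.Rational using (ℚ; 0ℚ; _+_; _*_; -_; _-_; 1/_; ≢-nonZero)
open import Data.Rational.Properties using (_≟_)
open import Data.Product using (_×_; _,_; proj₁; proj₂)
open import Data.Bool using (Bool; true; false)
open import Relation.Nullary using (yes; no)

-- Total inverse on ℚ: x ↦ 1/x for x ≠ 0 (value at 0 is irrelevant here,
-- it is only used on nonzero arguments under the theorem's hypotheses).
inv : ℚ → ℚ
inv x with x ≟ 0ℚ
... | yes _ = 0ℚ
... | no x≢0 = 1/_ x {{≢-nonZero x≢0}}

-- pairs of rationals, indexed by Bool (false = 0, true = 1)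
Pair : Set
Pair = ℚ × ℚ

comp : Pair → Bool → ℚ
comp p false = proj₁ p
comp p true  = proj₂ p

perp : Pair → Pair
perp (p₀ , p₁) = (p₁ , - p₀)

normSq : Pair → ℚ
normSq (p₀ , p₁) = p₀ * p₀ + p₁ * p₁

entry : ℚ → Pair → Pair → Pair → Bool → Bool → Bool → ℚ
entry b p q r i j k =
  b * comp (perp p) i * comp (perp q) j * comp (perp r) k
  + comp p i * comp (perp q) j * comp (perp r) k * inv (normSq p)
  + comp (perp p) i * comp q j * comp (perp r) k * inv (normSq q)
  + comp (perp p) i * comp (perp q) j * comp r k * inv (normSq r)

hyperdet : (Bool → Bool → Bool → ℚ) → ℚ
hyperdet a =
  a000 * a000 * a111 * a111 + a001 * a001 * a110 * a110
  + a010 * a010 * a101 * a101 + a100 * a100 * a011 * a011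
  - two * (a000 * a111 * a001 * a110 + a000 * a111 * a010 * a101
           + a000 * a111 * a011 * a100 + a001 * a110 * a010 * a101
           + a001 * a110 * a011 * a100 + a010 * a101 * a011 * a100)
  + four * (a000 * a011 * a101 * a110 + a001 * a010 * a100 * a111)
  where
  open import Data.Rational using (1ℚ)
  two = 1ℚ + 1ℚ
  four = two + two
  a000 = a false false false
  a001 = a false false true
  a010 = a false true false
  a011 = a false true true
  a100 = a true false false
  a101 = a true false true
  a110 = a true true false
  a111 = a true true true

-- Every slice aₖ of the hypermatrix along the first factor has the form cₖ X + dₖ Y with dₖ = pᴸₖ,
-- X = qᴸ⊗rᴸ of rank one and Y = q⊗rᴸ/|q|² + qᴸ⊗r/|r|²; X is orthogonal to Y for the polar form of
-- the determinant and -det Y = 1, so -det (λ a₀ + μ a₁) = (λ pᴸ₀ + μ pᴸ₁)². This gives the face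
-- identities (the other two directions are symmetric), and the hyperdeterminant vanishes because it
-- is the discriminant of that binary quadratic form, a perfect square.
module Submission where

open import Defs
open import Data.Bool using (Bool; true; false)
open import Data.Integer using (+_)
open import Data.Product using (_×_; _,_)
open import Data.Rational using (ℚ; 0ℚ; 1ℚ; _+_; _*_; _-_; -_; _/_; _<_; _≤_; ≢-nonZero; positive; negative)
open import Data.Rational.Properties
  using (_≟_; +-*-commutativeRing; <-cmp; ≤-refl; <⇒≤; <⇒≢; +-mono-<-≤; +-mono-≤-<;
         *-identityʳ; *-inverseˡ; positive⁻¹; pos*pos⇒pos; neg*neg⇒pos)
open import Relation.Binary.Definitions using (tri<; tri≈; tri>)
open import Relation.Binary.PropositionalEquality
  using (_≡_; _≢_; refl; trans; cong; cong₂; ≢-sym; module ≡-Reasoning)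
open import Relation.Nullary using (yes; no; contradiction)
open import Relation.Nullary.Decidable using (dec⇒maybe)
open import Tactic.RingSolver using (solve-∀)
open import Tactic.RingSolver.Core.AlmostCommutativeRing
  using (AlmostCommutativeRing; fromCommutativeRing)

ℚ-ring : AlmostCommutativeRing _ _
ℚ-ring = fromCommutativeRing +-*-commutativeRing (λ x → dec⇒maybe (0ℚ ≟ x))

Matrix : Set
Matrix = Bool → Bool → ℚ

infixl 6 _⊞_
infix 4 _≗₂_

_⊞_ : Matrix → Matrix → Matrix
(M ⊞ N) i j = M i j + N i j

negDet : Matrix → ℚ
negDet M = M false true * M true false - M false false * M true true

negDetPolar : Matrix → Matrix → ℚ
negDetPolar M N = negDet (M ⊞ N) - negDet M - negDet N

discriminant : ℚ → ℚ → ℚ → ℚ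
discriminant A B C = B * B - + 4 / 1 * A * C

_≗₂_ : Matrix → Matrix → Set
M ≗₂ N = ∀ i j → M i j ≡ N i j

negDet-cong : ∀ {M N} → M ≗₂ N → negDet M ≡ negDet N
negDet-cong M≗N =
  cong₂ _-_ (cong₂ _*_ (M≗N false true) (M≗N true false)) (cong₂ _*_ (M≗N false false) (M≗N true true))

negDetPolar-cong : ∀ {M M′ N N′} → M ≗₂ M′ → N ≗₂ N′ → negDetPolar M N ≡ negDetPolar M′ N′
negDetPolar-cong M≗M′ N≗N′ =
  cong₂ _-_ (cong₂ _-_ (negDet-cong (λ i j → cong₂ _+_ (M≗M′ i j) (N≗N′ i j))) (negDet-cong M≗M′))
            (negDet-cong N≗N′)

hyperdet-≡-discriminant : ∀ a →
  hyperdet a ≡ discriminant (negDet (a false)) (negDetPolar (a false) (a true)) (negDet (a true))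
hyperdet-≡-discriminant a =
  identity (a false false false) (a false false true) (a false true false) (a false true true)
           (a true false false) (a true false true) (a true true false) (a true true true)
  where
  identity : ∀ a₀₀₀ a₀₀₁ a₀₁₀ a₀₁₁ a₁₀₀ a₁₀₁ a₁₁₀ a₁₁₁ →
    let two = 1ℚ + 1ℚ
        A = a₀₀₁ * a₀₁₀ - a₀₀₀ * a₀₁₁
        C = a₁₀₁ * a₁₁₀ - a₁₀₀ * a₁₁₁
        B = (a₀₀₁ + a₁₀₁) * (a₀₁₀ + a₁₁₀) - (a₀₀₀ + a₁₀₀) * (a₀₁₁ + a₁₁₁) - A - C
    in a₀₀₀ * a₀₀₀ * a₁₁₁ * a₁₁₁ + a₀₀₁ * a₀₀₁ * a₁₁₀ * a₁₁₀
       + a₀₁₀ * a₀₁₀ * a₁₀₁ * a₁₀₁ + a₁₀₀ * a₁₀₀ * a₀₁₁ * a₀₁₁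
       - two * (a₀₀₀ * a₁₁₁ * a₀₀₁ * a₁₁₀ + a₀₀₀ * a₁₁₁ * a₀₁₀ * a₁₀₁
                + a₀₀₀ * a₁₁₁ * a₀₁₁ * a₁₀₀ + a₀₀₁ * a₁₁₀ * a₀₁₀ * a₁₀₁
                + a₀₀₁ * a₁₁₀ * a₀₁₁ * a₁₀₀ + a₀₁₀ * a₁₀₁ * a₀₁₁ * a₁₀₀)
       + (two + two) * (a₀₀₀ * a₀₁₁ * a₁₀₁ * a₁₁₀ + a₀₀₁ * a₀₁₀ * a₁₀₀ * a₁₁₁)
       ≡ B * B - + 4 / 1 * A * C
  identity = solve-∀ ℚ-ring

discriminant-of-square : ∀ {A B C} d d′ s →
  A ≡ d * d * s → B ≡ + 2 / 1 * d * d′ * s → C ≡ d′ * d′ * s → discriminant A B C ≡ 0ℚ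
discriminant-of-square d d′ s refl refl refl = identity d d′ s
  where
  identity : ∀ d d′ s →
    (+ 2 / 1 * d * d′ * s) * (+ 2 / 1 * d * d′ * s) - + 4 / 1 * (d * d * s) * (d′ * d′ * s) ≡ 0ℚ
  identity = solve-∀ ℚ-ring

square-positive : ∀ {x} → x ≢ 0ℚ → 0ℚ < x * x
square-positive {x} x≢0 with <-cmp x 0ℚ
... | tri< x<0 _ _ = positive⁻¹ (x * x) {{neg*neg⇒pos x {{negative x<0}} x {{negative x<0}}}}
... | tri≈ _ x≡0 _ = contradiction x≡0 x≢0
... | tri> _ _ x>0 = positive⁻¹ (x * x) {{pos*pos⇒pos x {{positive x>0}} x {{positive x>0}}}}

square-nonNegative : ∀ x → 0ℚ ≤ x * x
square-nonNegative x with x ≟ 0ℚ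
... | yes refl = ≤-refl
... | no x≢0   = <⇒≤ (square-positive x≢0)

normSq-positive : ∀ {u} → u ≢ (0ℚ , 0ℚ) → 0ℚ < normSq u
normSq-positive {u₀ , u₁} u≢0 with u₀ ≟ 0ℚ | u₁ ≟ 0ℚ
... | no u₀≢0  | _         = +-mono-<-≤ (square-positive u₀≢0) (square-nonNegative u₁)
... | yes refl | no u₁≢0   = +-mono-≤-< (square-nonNegative 0ℚ) (square-positive u₁≢0)
... | yes refl | yes refl  = contradiction refl u≢0

inv-inverseˡ : ∀ {x} → x ≢ 0ℚ → inv x * x ≡ 1ℚ
inv-inverseˡ {x} x≢0 with x ≟ 0ℚ
... | yes x≡0  = contradiction x≡0 x≢0
... | no x≢0′  = *-inverseˡ x {{≢-nonZero x≢0′}}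

inv-normSq-inverseˡ : ∀ {u} → u ≢ (0ℚ , 0ℚ) → inv (normSq u) * normSq u ≡ 1ℚ
inv-normSq-inverseˡ u≢0 = inv-inverseˡ (≢-sym (<⇒≢ (normSq-positive u≢0)))

pencil : (c d : ℚ) (u v : Pair) → Matrix
pencil c d u v i j =
  c * (comp (perp u) i * comp (perp v) j)
  + d * (inv (normSq u) * (comp u i * comp (perp v) j) + inv (normSq v) * (comp (perp u) i * comp v j))

negDet-pencil : ∀ c d u v →
  negDet (pencil c d u v) ≡ d * d * (inv (normSq u) * normSq u * (inv (normSq v) * normSq v))
negDet-pencil c d u@(u₀ , u₁) v@(v₀ , v₁) = identity c d (inv (normSq u)) (inv (normSq v)) u₀ u₁ v₀ v₁
  where
  identity : ∀ c d U V u₀ u₁ v₀ v₁ →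
    let m = λ x xᴸ y yᴸ → c * (xᴸ * yᴸ) + d * (U * (x * yᴸ) + V * (xᴸ * y))
    in m u₀ u₁ v₁ (- v₀) * m u₁ (- u₀) v₀ v₁ - m u₀ u₁ v₀ v₁ * m u₁ (- u₀) v₁ (- v₀)
       ≡ d * d * (U * (u₀ * u₀ + u₁ * u₁) * (V * (v₀ * v₀ + v₁ * v₁)))
  identity = solve-∀ ℚ-ring

pencil-⊞ : ∀ c d c′ d′ u v → pencil c d u v ⊞ pencil c′ d′ u v ≗₂ pencil (c + c′) (d + d′) u v
pencil-⊞ c d c′ d′ u v i j =
  identity c d c′ d′ (inv (normSq u)) (inv (normSq v)) (comp u i) (comp (perp u) i) (comp v j) (comp (perp v) j)
  where
  identity : ∀ c d c′ d′ U V x xᴸ y yᴸ →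
    c * (xᴸ * yᴸ) + d * (U * (x * yᴸ) + V * (xᴸ * y)) + (c′ * (xᴸ * yᴸ) + d′ * (U * (x * yᴸ) + V * (xᴸ * y)))
    ≡ (c + c′) * (xᴸ * yᴸ) + (d + d′) * (U * (x * yᴸ) + V * (xᴸ * y))
  identity = solve-∀ ℚ-ring

negDetPolar-pencil : ∀ c d c′ d′ u v →
  negDetPolar (pencil c d u v) (pencil c′ d′ u v)
  ≡ + 2 / 1 * d * d′ * (inv (normSq u) * normSq u * (inv (normSq v) * normSq v))
negDetPolar-pencil c d c′ d′ u v = begin
  negDet (pencil c d u v ⊞ pencil c′ d′ u v) - negDet (pencil c d u v) - negDet (pencil c′ d′ u v)
    ≡⟨ cong₂ _-_ (cong₂ _-_ (trans (negDet-cong (pencil-⊞ c d c′ d′ u v)) (negDet-pencil (c + c′) (d + d′) u v))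
                            (negDet-pencil c d u v))
                 (negDet-pencil c′ d′ u v) ⟩
  (d + d′) * (d + d′) * s - d * d * s - d′ * d′ * s
    ≡⟨ identity d d′ s ⟩
  + 2 / 1 * d * d′ * s ∎
  where
  open ≡-Reasoning
  s = inv (normSq u) * normSq u * (inv (normSq v) * normSq v)
  identity : ∀ d d′ s → (d + d′) * (d + d′) * s - d * d * s - d′ * d′ * s ≡ + 2 / 1 * d * d′ * s
  identity = solve-∀ ℚ-ring

negDet-pencil-nonZero : ∀ c d {u v} → u ≢ (0ℚ , 0ℚ) → v ≢ (0ℚ , 0ℚ) → negDet (pencil c d u v) ≡ d * d
negDet-pencil-nonZero c d {u} {v} u≢0 v≢0 = begin
  negDet (pencil c d u v)
    ≡⟨ negDet-pencil c d u v ⟩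
  d * d * (inv (normSq u) * normSq u * (inv (normSq v) * normSq v))
    ≡⟨ cong (λ s → d * d * s) (cong₂ _*_ (inv-normSq-inverseˡ u≢0) (inv-normSq-inverseˡ v≢0)) ⟩
  d * d * 1ℚ
    ≡⟨ *-identityʳ (d * d) ⟩
  d * d ∎
  where open ≡-Reasoning

rankOneCoeff : ℚ → Pair → Bool → ℚ
rankOneCoeff b u i = b * comp (perp u) i + inv (normSq u) * comp u i

module _ (b : ℚ) (p q r : Pair) where

  entry-slice₁ : ∀ i → entry b p q r i ≗₂
    pencil (rankOneCoeff b p i) (comp (perp p) i) q r
  entry-slice₁ i j k =
    identity b (comp p i) (comp (perp p) i) (comp q j) (comp (perp q) j) (comp r k) (comp (perp r) k)
               (inv (normSq p)) (inv (normSq q)) (inv (normSq r))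
    where
    identity : ∀ b x xᴸ y yᴸ z zᴸ X Y Z →
      b * xᴸ * yᴸ * zᴸ + x * yᴸ * zᴸ * X + xᴸ * y * zᴸ * Y + xᴸ * yᴸ * z * Z
      ≡ (b * xᴸ + X * x) * (yᴸ * zᴸ) + xᴸ * (Y * (y * zᴸ) + Z * (yᴸ * z))
    identity = solve-∀ ℚ-ring

  entry-slice₂ : ∀ j → (λ i k → entry b p q r i j k) ≗₂
    pencil (rankOneCoeff b q j) (comp (perp q) j) p r
  entry-slice₂ j i k =
    identity b (comp p i) (comp (perp p) i) (comp q j) (comp (perp q) j) (comp r k) (comp (perp r) k)
               (inv (normSq p)) (inv (normSq q)) (inv (normSq r))
    where
    identity : ∀ b x xᴸ y yᴸ z zᴸ X Y Z →
      b * xᴸ * yᴸ * zᴸ + x * yᴸ * zᴸ * X + xᴸ * y * zᴸ * Y + xᴸ * yᴸ * z * Z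
      ≡ (b * yᴸ + Y * y) * (xᴸ * zᴸ) + yᴸ * (X * (x * zᴸ) + Z * (xᴸ * z))
    identity = solve-∀ ℚ-ring

  entry-slice₃ : ∀ k → (λ i j → entry b p q r i j k) ≗₂
    pencil (rankOneCoeff b r k) (comp (perp r) k) p q
  entry-slice₃ k i j =
    identity b (comp p i) (comp (perp p) i) (comp q j) (comp (perp q) j) (comp r k) (comp (perp r) k)
               (inv (normSq p)) (inv (normSq q)) (inv (normSq r))
    where
    identity : ∀ b x xᴸ y yᴸ z zᴸ X Y Z →
      b * xᴸ * yᴸ * zᴸ + x * yᴸ * zᴸ * X + xᴸ * y * zᴸ * Y + xᴸ * yᴸ * z * Z
      ≡ (b * zᴸ + Z * z) * (xᴸ * yᴸ) + zᴸ * (X * (x * yᴸ) + Y * (xᴸ * y))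
    identity = solve-∀ ℚ-ring

  negDet-slice₁ : q ≢ (0ℚ , 0ℚ) → r ≢ (0ℚ , 0ℚ) → ∀ i →
    negDet (entry b p q r i) ≡ comp (perp p) i * comp (perp p) i
  negDet-slice₁ q≢0 r≢0 i =
    trans (negDet-cong (entry-slice₁ i)) (negDet-pencil-nonZero (rankOneCoeff b p i) (comp (perp p) i) q≢0 r≢0)

  negDet-slice₂ : p ≢ (0ℚ , 0ℚ) → r ≢ (0ℚ , 0ℚ) → ∀ j →
    negDet (λ i k → entry b p q r i j k) ≡ comp (perp q) j * comp (perp q) j
  negDet-slice₂ p≢0 r≢0 j =
    trans (negDet-cong (entry-slice₂ j)) (negDet-pencil-nonZero (rankOneCoeff b q j) (comp (perp q) j) p≢0 r≢0)

  negDet-slice₃ : p ≢ (0ℚ , 0ℚ) → q ≢ (0ℚ , 0ℚ) → ∀ k →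
    negDet (λ i j → entry b p q r i j k) ≡ comp (perp r) k * comp (perp r) k
  negDet-slice₃ p≢0 q≢0 k =
    trans (negDet-cong (entry-slice₃ k)) (negDet-pencil-nonZero (rankOneCoeff b r k) (comp (perp r) k) p≢0 q≢0)

  hyperdet-entry : hyperdet (entry b p q r) ≡ 0ℚ
  hyperdet-entry =
    trans (hyperdet-≡-discriminant (entry b p q r))
          (discriminant-of-square (d false) (d true) s
            (trans (negDet-cong (entry-slice₁ false)) (negDet-pencil (c false) (d false) q r))
            (trans (negDetPolar-cong (entry-slice₁ false) (entry-slice₁ true))
                   (negDetPolar-pencil (c false) (d false) (c true) (d true) q r))
            (trans (negDet-cong (entry-slice₁ true)) (negDet-pencil (c true) (d true) q r)))
    where
    s = inv (normSq q) * normSq q * (inv (normSq r) * normSq r)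
    c d : Bool → ℚ
    c = rankOneCoeff b p
    d = comp (perp p)

mainTheorem5 : (b : ℚ) (p q r : ℚ × ℚ) →
    p ≢ (0ℚ , 0ℚ) → q ≢ (0ℚ , 0ℚ) → r ≢ (0ℚ , 0ℚ) →
    ((k : Bool) →
      (entry b p q r k false true * entry b p q r k true false
        - entry b p q r k false false * entry b p q r k true true
        ≡ comp (perp p) k * comp (perp p) k)
      × (entry b p q r false k true * entry b p q r true k false
        - entry b p q r false k false * entry b p q r true k true
        ≡ comp (perp q) k * comp (perp q) k)
      × (entry b p q r false true k * entry b p q r true false k
        - entry b p q r false false k * entry b p q r true true k
        ≡ comp (perp r) k * comp (perp r) k))
    × hyperdet (entry b p q r) ≡ 0ℚ
mainTheorem5 b p q r p≢0 q≢0 r≢0 =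
  (λ k → negDet-slice₁ b p q r q≢0 r≢0 k , negDet-slice₂ b p q r p≢0 r≢0 k , negDet-slice₃ b p q r p≢0 q≢0 k)
  , hyperdet-entry b p q r
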